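{- For every simple pattern term $p$, every $u\in\upsilon(p)$ and every $n\in\mathbb N$, we have $p(n)=u(n)$.
   Context: Fix a signature $\Sigma$, hole constants $\square_1,\square_2,\dots$ and an infinite countable set $X$ of variables, pairwise disjoint. $T(\Sigma,X)$ is the set of terms, $S(\Sigma,X)$ the set of substitutions (maps $X\to T(\Sigma,X)$ moving finitely many variables); composition $x(\sigma\theta)=(x\sigma)\theta$, $\emptyset$ the identity, $\sigma^0=\emptyset$, $\sigma^{n+1}=\sigma^n\sigma$. A 1-context is a term over $\Sigma\cup\{\square_1,\square_2,\dots\}$ and $X$ containing $\square_1$ and no other hole; $c(s)$ replaces every $\square_1$ by $s$; $c^0=\square_1$, $c^{n+1}=c(c^n)$; $\chi^{(1)}$ is the set of 1-contexts without variables. $\Upsilon$ is a set of new unary symbols $c^{a,b}$ ($c\in\chi^{(1)}$, $a,b\in\mathbb N$). For $u\in T(\Sigma\cup\Upsilon,X)$, $u(n)\in T(\Sigma,X)$ is obtained by replacing every symbol $c^{a,b}$ by the nesting $c^{a\times n+b}$. $u\sim v$ iff $u(n)=v(n)$ for all $n$; $[u]$ is the $\sim$-class of $u$. A pattern term is $p=(s,(\sigma,\mu))$ with $s\in T(\Sigma,X)$, $\sigma,\mu\in S(\Sigma,X)$; $p(n)=s\sigma^n\mu$. It is simple if for every $x\in\mathit{Var}(s)$ there exist $c\in\chi^{(1)}$, $a,b\in\mathbb N$ and $t\in T(\Sigma,X)$ with $\sigma(x)=c^a(x)$ and $\mu(x)=c^b(t)$. Then $\upsilon(p)=[s\theta_p]$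 where $\theta_p$ maps each $x\in\mathit{Var}(s)$ (with such $c,a,b,t$) to $\mu(x)$ if $\sigma(x)=x$, and to $c^{a,b}(t)$ otherwise. -}

module Defs where

open import Data.Nat using (ℕ; zero; suc; _+_; _*_; _≤_)
open import Data.Fin using (Fin)
open import Data.Vec using (Vec; []; _∷_; lookup)
open import Data.List using (List; []; _∷_; _++_)
open import Data.List.Membership.Propositional using (_∈_)
open import Data.Product using (Σ; ∃; _×_; _,_)
open import Data.Sum using (_⊎_)
open import Relation.Binary.PropositionalEquality using (_≡_; _≢_)

record Signature : Set₁ where
  field
    Sym   : Set
    arity : Sym → ℕ
open Signature public

data Term (S : Signature) : Set where
  var : ℕ → Term S
  fun : (f : Sym S) → Vec (Term S) (arity S f) → Term S

-- Ground 1-contexts: terms over Σ ∪ {□₁} with no variables ...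
data Ctx (S : Signature) : Set where
  hole : Ctx S
  cfun : (f : Sym S) → Vec (Ctx S) (arity S f) → Ctx S

-- ... that contain □₁.
data HasHole {S : Signature} : Ctx S → Set where
  here  : HasHole hole
  inArg : {f : Sym S} {cs : Vec (Ctx S) (arity S f)} (i : Fin (arity S f)) →
          HasHole (lookup cs i) → HasHole (cfun f cs)

-- Terms over Σ ∪ Υ, with Υ = { c^{a,b} | c ∈ χ^(1), a b ∈ ℕ }.
data UTerm (S : Signature) : Set where
  uvar : ℕ → UTerm S
  ufun : (f : Sym S) → Vec (UTerm S) (arity S f) → UTerm S
  ups  : (c : Ctx S) → HasHole c → (a b : ℕ) → UTerm S → UTerm S

Subst : Signature → Set
Subst S = ℕ → Term S

module _ {S : Signature} where

  FinSupp : Subst S → Set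
  FinSupp σ = ∃ λ N → ∀ x → N ≤ x → σ x ≡ var x

  mutual
    _⟨_⟩ : Term S → Subst S → Term S
    var x    ⟨ σ ⟩ = σ x
    fun f ts ⟨ σ ⟩ = fun f (substs ts σ)

    substs : ∀ {k} → Vec (Term S) k → Subst S → Vec (Term S) k
    substs []       σ = []
    substs (t ∷ ts) σ = (t ⟨ σ ⟩) ∷ substs ts σ

  _⊙_ : Subst S → Subst S → Subst S
  (σ ⊙ θ) x = (σ x) ⟨ θ ⟩

  idS : Subst S
  idS = var

  _^S_ : Subst S → ℕ → Subst S
  σ ^S zero  = idS
  σ ^S suc n = (σ ^S n) ⊙ σ

  mutual
    vars : Term S → List ℕ
    vars (var x)    = x ∷ []
    vars (fun f ts) = varsV ts

    varsV : ∀ {k} → Vec (Term S) k → List ℕ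
    varsV []       = []
    varsV (t ∷ ts) = vars t ++ varsV ts

  mutual
    plug : Ctx S → Term S → Term S
    plug hole       s = s
    plug (cfun f cs) s = fun f (plugV cs s)

    plugV : ∀ {k} → Vec (Ctx S) k → Term S → Vec (Term S) k
    plugV []       s = []
    plugV (c ∷ cs) s = plug c s ∷ plugV cs s

  iter : Ctx S → ℕ → Term S → Term S
  iter c zero    s = s
  iter c (suc n) s = plug c (iter c n s)

  mutual
    eval : UTerm S → ℕ → Term S
    eval (uvar x)        n = var x
    eval (ufun f us)     n = fun f (evalV us n)
    eval (ups c h a b u) n = iter c (a * n + b) (eval u n)

    evalV : ∀ {k} → Vec (UTerm S) k → ℕ → Vec (Term S) k
    evalV []       n = []
    evalV (u ∷ us) n = eval u n ∷ evalV us n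

  _∼_ : UTerm S → UTerm S → Set
  u ∼ v = ∀ n → eval u n ≡ eval v n

  mutual
    emb : Term S → UTerm S
    emb (var x)    = uvar x
    emb (fun f ts) = ufun f (embV ts)

    embV : ∀ {k} → Vec (Term S) k → Vec (UTerm S) k
    embV []       = []
    embV (t ∷ ts) = emb t ∷ embV ts

  mutual
    _⟪_⟫ : Term S → (ℕ → UTerm S) → UTerm S
    var x    ⟪ θ ⟫ = θ x
    fun f ts ⟪ θ ⟫ = ufun f (usubsts ts θ)

    usubsts : ∀ {k} → Vec (Term S) k → (ℕ → UTerm S) → Vec (UTerm S) k
    usubsts []       θ = []
    usubsts (t ∷ ts) θ = (t ⟪ θ ⟫) ∷ usubsts ts θ

record PatternTerm (S : Signature) : Set where
  field
    base  : Term S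
    sig   : Subst S
    mu    : Subst S
    sigFin : FinSupp sig
    muFin  : FinSupp mu
open PatternTerm public

module _ {S : Signature} where

  _at_ : PatternTerm S → ℕ → Term S
  p at n = base p ⟨ (sig p ^S n) ⊙ mu p ⟩

  record SimpleWit (σ μ : Subst S) (x : ℕ) : Set where
    field
      ctx     : Ctx S
      ctxHole : HasHole ctx
      a       : ℕ
      b       : ℕ
      t       : Term S
      σ-eq    : σ x ≡ iter ctx a (var x)
      μ-eq    : μ x ≡ iter ctx b t
  open SimpleWit public

  -- p is simple (given together with a choice of the witnesses)
  Simple : PatternTerm S → Set
  Simple p = ∀ x → x ∈ vars (base p) → SimpleWit (sig p) (mu p) x

  -- θ agrees with θ_p (built from the chosen witnesses) on Var(s)
  IsThetaP : (p : PatternTerm S) → Simple p → (ℕ → UTerm S) → Set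
  IsThetaP p w θ = ∀ x (o : x ∈ vars (base p)) →
      (sig p x ≡ var x × θ x ≡ emb (mu p x))
    ⊎ (sig p x ≢ var x ×
       θ x ≡ ups (ctx (w x o)) (ctxHole (w x o)) (a (w x o)) (b (w x o)) (emb (t (w x o))))

  _∈υ[_,_] : UTerm S → (p : PatternTerm S) → Simple p → Set
  u ∈υ[ p , w ] = Σ (ℕ → UTerm S) λ θ → IsThetaP p w θ × (u ∼ (base p ⟪ θ ⟫))

-- Substituting σⁿμ into s agrees with evaluating sθ_p at n variable by variable:
-- a variable fixed by σ is sent to μ(x) in both, and otherwise σ(x) = cᵃ(x) gives
-- σⁿ(x) = c^{a n}(x) because substitution commutes with plugging into a ground
-- context, so σⁿμ(x) = c^{a n}(c^b(t)) = c^{a n + b}(t), which is c^{a,b}(t) at n.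
module Submission where

open import Defs
open import Data.Nat using (ℕ; zero; suc; _+_; _*_)
open import Data.Nat.Properties using (*-suc; +-comm; *-zeroʳ)
open import Data.Vec using (Vec; []; _∷_)
open import Data.List.Membership.Propositional using (_∈_)
open import Data.List.Membership.Propositional.Properties using (∈-++⁺ˡ; ∈-++⁺ʳ)
open import Data.List.Relation.Unary.Any using (here)
open import Data.Product using (_,_)
open import Data.Sum using (inj₁; inj₂)
open import Relation.Binary.PropositionalEquality
  using (_≡_; refl; sym; trans; cong; cong₂; module ≡-Reasoning)

module _ {S : Signature} where

  mutual
    plug-⟨⟩ : (c : Ctx S) (s : Term S) (τ : Subst S) → plug c s ⟨ τ ⟩ ≡ plug c (s ⟨ τ ⟩)
    plug-⟨⟩ hole        s τ = refl
    plug-⟨⟩ (cfun f cs) s τ = cong (fun f) (plugV-substs cs s τ)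

    plugV-substs : ∀ {k} (cs : Vec (Ctx S) k) (s : Term S) (τ : Subst S) →
                   substs (plugV cs s) τ ≡ plugV cs (s ⟨ τ ⟩)
    plugV-substs []       s τ = refl
    plugV-substs (c ∷ cs) s τ = cong₂ _∷_ (plug-⟨⟩ c s τ) (plugV-substs cs s τ)

  iter-⟨⟩ : (c : Ctx S) (m : ℕ) (s : Term S) (τ : Subst S) →
            iter c m s ⟨ τ ⟩ ≡ iter c m (s ⟨ τ ⟩)
  iter-⟨⟩ c zero    s τ = refl
  iter-⟨⟩ c (suc m) s τ = trans (plug-⟨⟩ c (iter c m s) τ) (cong (plug c) (iter-⟨⟩ c m s τ))

  iter-+ : (c : Ctx S) (m k : ℕ) (s : Term S) → iter c m (iter c k s) ≡ iter c (m + k) s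
  iter-+ c zero    k s = refl
  iter-+ c (suc m) k s = cong (plug c) (iter-+ c m k s)

  ^S-fixed : (σ : Subst S) (x : ℕ) → σ x ≡ var x → ∀ n → (σ ^S n) x ≡ var x
  ^S-fixed σ x σx≡x zero    = refl
  ^S-fixed σ x σx≡x (suc n) = trans (cong (_⟨ σ ⟩) (^S-fixed σ x σx≡x n)) σx≡x

  ^S-iter : (σ : Subst S) (x : ℕ) (c : Ctx S) (a : ℕ) → σ x ≡ iter c a (var x) →
            ∀ n → (σ ^S n) x ≡ iter c (a * n) (var x)
  ^S-iter σ x c a σx≡cᵃx zero = cong (λ k → iter c k (var x)) (sym (*-zeroʳ a))
  ^S-iter σ x c a σx≡cᵃx (suc n) = begin
    (σ ^S n) x ⟨ σ ⟩                  ≡⟨ cong (_⟨ σ ⟩) (^S-iter σ x c a σx≡cᵃx n) ⟩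
    iter c (a * n) (var x) ⟨ σ ⟩      ≡⟨ iter-⟨⟩ c (a * n) (var x) σ ⟩
    iter c (a * n) (σ x)              ≡⟨ cong (iter c (a * n)) σx≡cᵃx ⟩
    iter c (a * n) (iter c a (var x)) ≡⟨ iter-+ c (a * n) a (var x) ⟩
    iter c (a * n + a) (var x)        ≡⟨ cong (λ k → iter c k (var x)) a*n+a≡a*[1+n] ⟩
    iter c (a * suc n) (var x)        ∎
    where
    open ≡-Reasoning
    a*n+a≡a*[1+n] : a * n + a ≡ a * suc n
    a*n+a≡a*[1+n] = trans (+-comm (a * n) a) (sym (*-suc a n))

  mutual
    eval-emb : (t : Term S) (n : ℕ) → eval (emb t) n ≡ t
    eval-emb (var x)    n = refl
    eval-emb (fun f ts) n = cong (fun f) (evalV-embV ts n)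

    evalV-embV : ∀ {k} (ts : Vec (Term S) k) (n : ℕ) → evalV (embV ts) n ≡ ts
    evalV-embV []       n = refl
    evalV-embV (t ∷ ts) n = cong₂ _∷_ (eval-emb t n) (evalV-embV ts n)

  mutual
    ⟨⟩≡eval-⟪⟫ : (s : Term S) (τ : Subst S) (θ : ℕ → UTerm S) (n : ℕ) →
                 (∀ x → x ∈ vars s → τ x ≡ eval (θ x) n) → s ⟨ τ ⟩ ≡ eval (s ⟪ θ ⟫) n
    ⟨⟩≡eval-⟪⟫ (var x)    τ θ n agree = agree x (here refl)
    ⟨⟩≡eval-⟪⟫ (fun f ts) τ θ n agree = cong (fun f) (substs≡evalV-usubsts ts τ θ n agree)

    substs≡evalV-usubsts : ∀ {k} (ts : Vec (Term S) k) (τ : Subst S) (θ : ℕ → UTerm S) (n : ℕ) →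
                           (∀ x → x ∈ varsV ts → τ x ≡ eval (θ x) n) →
                           substs ts τ ≡ evalV (usubsts ts θ) n
    substs≡evalV-usubsts []       τ θ n agree = refl
    substs≡evalV-usubsts (t ∷ ts) τ θ n agree =
      cong₂ _∷_ (⟨⟩≡eval-⟪⟫ t τ θ n (λ x x∈t → agree x (∈-++⁺ˡ x∈t)))
                (substs≡evalV-usubsts ts τ θ n (λ x x∈ts → agree x (∈-++⁺ʳ (vars t) x∈ts)))

  ^S⊙-iter : (σ μ : Subst S) (x : ℕ) (c : Ctx S) (a b : ℕ) (t : Term S) →
             σ x ≡ iter c a (var x) → μ x ≡ iter c b t →
             ∀ n → ((σ ^S n) ⊙ μ) x ≡ iter c (a * n + b) t
  ^S⊙-iter σ μ x c a b t σx≡cᵃx μx≡cᵇt n = begin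
    (σ ^S n) x ⟨ μ ⟩             ≡⟨ cong (_⟨ μ ⟩) (^S-iter σ x c a σx≡cᵃx n) ⟩
    iter c (a * n) (var x) ⟨ μ ⟩ ≡⟨ iter-⟨⟩ c (a * n) (var x) μ ⟩
    iter c (a * n) (μ x)         ≡⟨ cong (iter c (a * n)) μx≡cᵇt ⟩
    iter c (a * n) (iter c b t)  ≡⟨ iter-+ c (a * n) b t ⟩
    iter c (a * n + b) t         ∎
    where open ≡-Reasoning

  θ-correct : (p : PatternTerm S) (w : Simple p) (θ : ℕ → UTerm S) → IsThetaP p w θ →
              ∀ n x → x ∈ vars (base p) → ((sig p ^S n) ⊙ mu p) x ≡ eval (θ x) n
  θ-correct p w θ isθ n x x∈s with isθ x x∈s
  ... | inj₁ (σx≡x , θx≡μx) = begin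
    (sig p ^S n) x ⟨ mu p ⟩  ≡⟨ cong (_⟨ mu p ⟩) (^S-fixed (sig p) x σx≡x n) ⟩
    mu p x                   ≡⟨ sym (eval-emb (mu p x) n) ⟩
    eval (emb (mu p x)) n    ≡⟨ cong (λ v → eval v n) (sym θx≡μx) ⟩
    eval (θ x) n             ∎
    where open ≡-Reasoning
  ... | inj₂ (_ , θx≡cᵃᵇt) = begin
    ((sig p ^S n) ⊙ mu p) x                   ≡⟨ ^S⊙-iter (sig p) (mu p) x cₓ aₓ bₓ tₓ (σ-eq wₓ) (μ-eq wₓ) n ⟩
    iter cₓ (aₓ * n + bₓ) tₓ                  ≡⟨ cong (iter cₓ (aₓ * n + bₓ)) (sym (eval-emb tₓ n)) ⟩
    iter cₓ (aₓ * n + bₓ) (eval (emb tₓ) n)   ≡⟨ cong (λ v → eval v n) (sym θx≡cᵃᵇt) ⟩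
    eval (θ x) n                              ∎
    where
    open ≡-Reasoning
    wₓ : SimpleWit (sig p) (mu p) x
    wₓ = w x x∈s
    cₓ : Ctx S
    cₓ = ctx wₓ
    aₓ bₓ : ℕ
    aₓ = a wₓ
    bₓ = b wₓ
    tₓ : Term S
    tₓ = t wₓ

lemma4p5 : {S : Signature} (p : PatternTerm S) (w : Simple p) (u : UTerm S) →
           u ∈υ[ p , w ] → (n : ℕ) → p at n ≡ eval u n
lemma4p5 p w u (θ , isθ , u∼sθ) n =
  trans (⟨⟩≡eval-⟪⟫ (base p) ((sig p ^S n) ⊙ mu p) θ n (θ-correct p w θ isθ n))
        (sym (u∼sθ n))
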